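{- Let $\mathfrak{c}$ be a circuit of the tiling matroid $\mathcal{T}_n$. Then there exists exactly one lattice upward triangle of $T_n$ that is strictly over-saturated by $\mathfrak{c}$, namely the triangular hull of $\mathfrak{c}$.
   Context: $T_n$ is a closed equilateral triangle of side length $n$ with horizontal base and apex up, subdivided by lines parallel to its sides at integer distances into unit equilateral triangles; upward-pointing ones are unit upward triangles (set $\mathfrak{u}(T_n)$). A lattice upward triangle of size $k$ is a translate of $T_k$ contained in $T_n$ that is a union of unit triangles; $\mathfrak{u}(T)$ is the set of unit upward triangles inside $T$. The tiling matroid $\mathcal{T}_n$ has ground set $\mathfrak{u}(T_n)$ and independent sets the subsets $\mathfrak{s}$ with $|\mathfrak{s}\cap\mathfrak{u}(T)|\le k$ for every lattice upward triangle $T$ of size $k$. A circuit is a minimal dependent set. A lattice upward triangle $T$ of size $k$ is strictly over-saturated by $\mathfrak{s}$ if $|\mathfrak{s}\cap\mathfrak{u}(T)|>k$. The triangular hull of a collection of unit triangles is the smallest lattice upward triangle of $T_n$ containing all of them. -}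

module Defs where

open import Data.Nat using (ℕ; zero; suc; _+_; _∸_; _≤_; _<_; _≤ᵇ_; _<ᵇ_)
open import Data.Bool using (Bool; true; false; _∧_; if_then_else_)
open import Data.Product using (_×_; _,_)
open import Data.List using (List; []; _∷_)
open import Data.List.Relation.Unary.All using (All)
open import Data.List.Relation.Unary.Unique.Propositional using (Unique)
open import Data.List.Membership.Propositional using (_∈_)
open import Relation.Nullary using (¬_)

-- A unit upward triangle of T_n is encoded by a pair (i , j)
-- with i + j < n; in barycentric terms it is the unit upward triangle with
-- coordinates (i , j , n - 1 - i - j) (distances, in lattice units, from the
-- three sides of T_n).
Unit : Set
Unit = ℕ × ℕ

InGround : ℕ → Unit → Set
InGround n (i , j) = i + j < n

-- A lattice upward triangle: corner offsets a, b and size k; the third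
-- offset is n - k - a - b.
record Tri : Set where
  constructor tri
  field
    a : ℕ
    b : ℕ
    size : ℕ
open Tri public

ValidTri : ℕ → Tri → Set
ValidTri n (tri a b k) = (1 ≤ k) × (a + b + k ≤ n)

InTri : Tri → Unit → Set
InTri (tri a b k) (i , j) = (a ≤ i) × (b ≤ j) × ((i ∸ a) + (j ∸ b) < k)

inTriᵇ : Tri → Unit → Bool
inTriᵇ (tri a b k) (i , j) = (a ≤ᵇ i) ∧ ((b ≤ᵇ j) ∧ (((i ∸ a) + (j ∸ b)) <ᵇ k))

-- |𝔰 ∩ 𝔲(T)| for a duplicate-free list 𝔰.
count : Tri → List Unit → ℕ
count T [] = 0
count T (u ∷ s) = if inTriᵇ T u then suc (count T s) else count T s

Sub : ℕ → List Unit → Set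
Sub n s = Unique s × All (InGround n) s

_⊆_ : List Unit → List Unit → Set
t ⊆ s = ∀ u → u ∈ t → u ∈ s

Independent : ℕ → List Unit → Set
Independent n s = ∀ T → ValidTri n T → count T s ≤ size T

Dependent : ℕ → List Unit → Set
Dependent n s = ¬ Independent n s

Circuit : ℕ → List Unit → Set
Circuit n c = Sub n c × Dependent n c
  × (∀ t → Sub n t → t ⊆ c → Dependent n t → c ⊆ t)

StrictlyOverSaturated : Tri → List Unit → Set
StrictlyOverSaturated T s = size T < count T s

_⊑_ : Tri → Tri → Set
tri a b k ⊑ tri a' b' k' = (a' ≤ a) × (b' ≤ b) × (a + b + k ≤ a' + b' + k')

IsHull : ℕ → List Unit → Tri → Set
IsHull n s T = ValidTri n T × All (InTri T) s
  × (∀ T' → ValidTri n T' → All (InTri T') s → T ⊑ T')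

-- If T is strictly over-saturated,
-- then c ∩ 𝔲(T) is already dependent, so by minimality c ⊆ 𝔲(T); hence every
-- over-saturated triangle contains the hull H of c, and all of them meet c in
-- |c| units.  Some triangle is over-saturated, and H is the smallest one
-- containing c, so H is over-saturated.  Removing one unit from c leaves an
-- independent set, so |c ∩ 𝔲(T)| ≤ size T + 1 for every T; an over-saturated T
-- therefore has size T < |c| ≤ size H + 1, and H ⊑ T with size T ≤ size H
-- forces T = H.
module Submission where

open import Defs
open import Data.Bool using (true; false)
open import Data.Nat using (ℕ; suc; s≤s; _+_; _∸_; _≤_; _<_; z≤n; _≤?_; _<?_)
open import Data.Nat.Properties
open import Data.List using (List; []; _∷_; length; filter)
open import Data.List.Properties using (filter-all; filter-idem)
open import Data.List.Extrema.Nat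
  using (argmin; argmax; f[argmin]≤f[⊤]; f[argmin]≤f[xs]; v≤f[argmin]⁺; f[⊥]≤f[argmax]; f[xs]≤f[argmax]; f[argmax]<v⁺)
open import Data.List.Relation.Unary.All using (All; _∷_; lookup; tabulate)
import Data.List.Relation.Unary.All as All
import Data.List.Relation.Unary.All.Properties as All
open import Data.List.Relation.Unary.AllPairs using (_∷_)
open import Data.List.Relation.Unary.Any using (here; there)
import Data.List.Relation.Unary.Unique.Propositional.Properties as Unique
open import Data.List.Membership.Propositional.Properties using (∈-filter⁻)
open import Data.Product using (Σ; _×_; _,_; proj₁; proj₂)
open import Data.Empty using (⊥-elim)
open import Relation.Nullary using (_because_)
open import Relation.Nullary.Reflects using (_×-reflects_)
open import Relation.Nullary.Decidable using (decidable-stable)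
open import Relation.Unary using (Decidable)
open import Relation.Binary.PropositionalEquality using (_≡_; refl; sym; trans; cong; cong₂; subst; subst₂; module ≡-Reasoning)
open import Algebra.Properties.CommutativeSemigroup +-commutativeSemigroup using (interchange)

-- Built on inTriᵇ, so that does (inTri? T u) is inTriᵇ T u definitionally.
inTri? : ∀ T → Decidable (InTri T)
inTri? (tri a b k) (i , j) =
  inTriᵇ (tri a b k) (i , j)
    because (≤ᵇ-reflects-≤ a i ×-reflects ≤ᵇ-reflects-≤ b j ×-reflects <ᵇ-reflects-< _ k)

count≡length∘filter : ∀ T s → count T s ≡ length (filter (inTri? T) s)
count≡length∘filter T [] = refl
count≡length∘filter T (u ∷ s) with inTriᵇ T u
... | true = cong suc (count≡length∘filter T s)
... | false = count≡length∘filter T s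

count-filter : ∀ T s → count T (filter (inTri? T) s) ≡ count T s
count-filter T s = begin
  count T (filter (inTri? T) s)                    ≡⟨ count≡length∘filter T (filter (inTri? T) s) ⟩
  length (filter (inTri? T) (filter (inTri? T) s)) ≡⟨ cong length (filter-idem (inTri? T) s) ⟩
  length (filter (inTri? T) s)                     ≡⟨ count≡length∘filter T s ⟨
  count T s                                        ∎
  where open ≡-Reasoning

count-all : ∀ {T s} → All (InTri T) s → count T s ≡ length s
count-all {T} {s} all = trans (count≡length∘filter T s) (cong length (filter-all (inTri? T) all))

count-∷-≤ : ∀ T u s → count T (u ∷ s) ≤ suc (count T s)
count-∷-≤ T u s with inTriᵇ T u
... | true = ≤-refl
... | false = n≤1+n _

offset-sum : ∀ {a b i j} → a ≤ i → b ≤ j → (i ∸ a) + (j ∸ b) + (a + b) ≡ i + j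
offset-sum {a} {b} {i} {j} a≤i b≤j = begin
  (i ∸ a) + (j ∸ b) + (a + b) ≡⟨ interchange (i ∸ a) (j ∸ b) a b ⟩
  (i ∸ a + a) + (j ∸ b + b)   ≡⟨ cong₂ _+_ (m∸n+n≡m a≤i) (m∸n+n≡m b≤j) ⟩
  i + j                       ∎
  where open ≡-Reasoning

InTri-intro : ∀ {a b k i j} → a ≤ i → b ≤ j → i + j < a + b + k → InTri (tri a b k) (i , j)
InTri-intro {a} {b} {k} a≤i b≤j i+j<e =
  a≤i , b≤j , +-cancelʳ-< (a + b) _ k
    (subst₂ _<_ (sym (offset-sum a≤i b≤j)) (+-comm (a + b) k) i+j<e)

InTri⇒sum< : ∀ {a b k i j} → InTri (tri a b k) (i , j) → i + j < a + b + k
InTri⇒sum< {a} {b} {k} (a≤i , b≤j , d<k) =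
  subst₂ _<_ (offset-sum a≤i b≤j) (+-comm k (a + b)) (+-monoˡ-< (a + b) d<k)

⊑⇒size≤ : ∀ {T T'} → T ⊑ T' → size T ≤ size T'
⊑⇒size≤ {tri a b k} {tri a' b' k'} (a'≤a , b'≤b , e≤e') =
  +-cancelˡ-≤ (a' + b') k k' (≤-trans (+-monoˡ-≤ k (+-mono-≤ a'≤a b'≤b)) e≤e')

tri-cong : ∀ {a b k a' b' k'} → a ≡ a' → b ≡ b' → k ≡ k' → tri a b k ≡ tri a' b' k'
tri-cong refl refl refl = refl

⊑∧size≥⇒≡ : ∀ {T T'} → T ⊑ T' → size T' ≤ size T → T' ≡ T
⊑∧size≥⇒≡ {tri a b k} {tri a' b' k'} T⊑T'@(a'≤a , b'≤b , e≤e') k'≤k =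
  tri-cong (≤-antisym a'≤a a≤a') (≤-antisym b'≤b b≤b') (≤-antisym k'≤k (⊑⇒size≤ T⊑T'))
  where
  a+b≤a'+b' : a + b ≤ a' + b'
  a+b≤a'+b' = +-cancelʳ-≤ k (a + b) (a' + b') (≤-trans e≤e' (+-monoʳ-≤ (a' + b') k'≤k))
  a≤a' : a ≤ a'
  a≤a' = +-cancelʳ-≤ b a a' (≤-trans a+b≤a'+b' (+-monoʳ-≤ a' b'≤b))
  b≤b' : b ≤ b'
  b≤b' = +-cancelˡ-≤ a b b' (≤-trans a+b≤a'+b' (+-monoˡ-≤ b' a'≤a))

module _ {A : Set} (f : A → ℕ) where

  minBy maxBy : A → List A → ℕ
  minBy x r = f (argmin f x r)
  maxBy x r = f (argmax f x r)

  minBy-≤ : ∀ x r → All (λ u → minBy x r ≤ f u) (x ∷ r)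
  minBy-≤ x r = f[argmin]≤f[⊤] {f = f} x r ∷ f[argmin]≤f[xs] {f = f} x r

  ≤-minBy : ∀ {v x r} → All (λ u → v ≤ f u) (x ∷ r) → v ≤ minBy x r
  ≤-minBy (v≤x ∷ v≤r) = v≤f[argmin]⁺ {f = f} v≤x v≤r

  ≤-maxBy : ∀ x r → All (λ u → f u ≤ maxBy x r) (x ∷ r)
  ≤-maxBy x r = f[⊥]≤f[argmax] {f = f} x r ∷ f[xs]≤f[argmax] {f = f} x r

  maxBy-< : ∀ {v x r} → All (λ u → f u < v) (x ∷ r) → maxBy x r < v
  maxBy-< (x<v ∷ r<v) = f[argmax]<v⁺ {f = f} x<v r<v

coordSum : Unit → ℕ
coordSum (i , j) = i + j

module _ (x : Unit) (r : List Unit) where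

  private
    a₀ b₀ top : ℕ
    a₀ = minBy proj₁ x r
    b₀ = minBy proj₂ x r
    top = suc (maxBy coordSum x r)

  hull : Tri
  hull = tri a₀ b₀ (top ∸ (a₀ + b₀))

  private
    corners<top : a₀ + b₀ < top
    corners<top = s≤s (≤-trans
      (+-mono-≤ (All.head (minBy-≤ proj₁ x r)) (All.head (minBy-≤ proj₂ x r)))
      (All.head (≤-maxBy coordSum x r)))

    hull-top : a₀ + b₀ + (top ∸ (a₀ + b₀)) ≡ top
    hull-top = m+[n∸m]≡n (<⇒≤ corners<top)

  hull-contains : All (InTri hull) (x ∷ r)
  hull-contains = tabulate λ {u} u∈ →
    InTri-intro (lookup (minBy-≤ proj₁ x r) u∈) (lookup (minBy-≤ proj₂ x r) u∈)
      (subst (coordSum u <_) (sym hull-top) (s≤s (lookup (≤-maxBy coordSum x r) u∈)))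

  hull-valid : ∀ {n} → All (InGround n) (x ∷ r) → ValidTri n hull
  hull-valid {n} inGround =
    m<n⇒0<n∸m corners<top , subst (_≤ n) (sym hull-top) (maxBy-< coordSum inGround)

  hull-least : ∀ T → All (InTri T) (x ∷ r) → hull ⊑ T
  hull-least (tri a b k) inT =
    ≤-minBy proj₁ (All.map proj₁ inT) ,
    ≤-minBy proj₂ (All.map (λ (_ , b≤j , _) → b≤j) inT) ,
    subst (_≤ a + b + k) (sym hull-top) (maxBy-< coordSum (All.map InTri⇒sum< inT))

  hull-isHull : ∀ {n} → All (InGround n) (x ∷ r) → IsHull n (x ∷ r) hull
  hull-isHull inGround = hull-valid inGround , hull-contains , λ T _ → hull-least T

count-common : ∀ {T T' s} → All (InTri T) s → All (InTri T') s → count T s ≡ count T' s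
count-common inT inT' = trans (count-all inT) (sym (count-all inT'))

oversaturated⇒contains : ∀ {n c T} → Circuit n c → ValidTri n T →
  StrictlyOverSaturated T c → All (InTri T) c
oversaturated⇒contains {c = c} {T} ((unique , inGround) , _ , minimal) valid over =
  tabulate λ u∈c → proj₂ (∈-filter⁻ (inTri? T) {xs = c} (c⊆c∩T _ u∈c))
  where
  c∩T : List Unit
  c∩T = filter (inTri? T) c

  c⊆c∩T : c ⊆ c∩T
  c⊆c∩T = minimal c∩T
    (Unique.filter⁺ (inTri? T) unique , All.filter⁺ (inTri? T) inGround)
    (λ _ u∈ → proj₁ (∈-filter⁻ (inTri? T) u∈))
    (λ indep → <⇒≱ over (subst (_≤ size T) (count-filter T c) (indep T valid)))

circuit-tail-independent : ∀ {n x r} → Circuit n (x ∷ r) → Independent n r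
circuit-tail-independent {r = r} ((x∉r ∷ unique , _ ∷ inGround) , _ , minimal) T valid =
  decidable-stable (count T r ≤? size T) λ r-overfull →
    let x∈r = minimal r (unique , inGround) (λ _ → there)
                      (λ indep → r-overfull (indep T valid)) _ (here refl)
    in lookup x∉r x∈r refl

circuit-count≤1+size : ∀ {n x r T} → Circuit n (x ∷ r) → ValidTri n T → count T (x ∷ r) ≤ suc (size T)
circuit-count≤1+size {x = x} {r} {T} circuit valid =
  ≤-trans (count-∷-≤ T x r) (s≤s (circuit-tail-independent circuit T valid))

module _ {n s H} (isHull : IsHull n s H)
         (contains : ∀ T → ValidTri n T → StrictlyOverSaturated T s → All (InTri T) s) where

  private
    H⊑ : ∀ {T} → ValidTri n T → All (InTri T) s → H ⊑ T
    H⊑ {T} = proj₂ (proj₂ isHull) T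

    H-contains : All (InTri H) s
    H-contains = proj₁ (proj₂ isHull)

  hull-oversaturated : Dependent n s → StrictlyOverSaturated H s
  hull-oversaturated dependent = decidable-stable (size H <? count H s) λ H-fits →
    dependent λ T valid → decidable-stable (count T s ≤? size T) λ T-overfull →
      let inT = contains T valid (≰⇒> T-overfull)
      in H-fits (≤-<-trans (⊑⇒size≤ (H⊑ valid inT))
                  (subst (size T <_) (count-common inT H-contains) (≰⇒> T-overfull)))

  oversaturated-unique : (∀ {T} → ValidTri n T → count T s ≤ suc (size T)) →
    ∀ T → ValidTri n T → StrictlyOverSaturated T s → T ≡ H
  oversaturated-unique count≤1+size T valid over =
    ⊑∧size≥⇒≡ (H⊑ valid inT)
      (≤-pred (≤-trans over
        (subst (_≤ suc (size H)) (count-common H-contains inT) (count≤1+size (proj₁ isHull)))))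
    where
    inT : All (InTri T) s
    inT = contains T valid over

proposition5p5 : (n : ℕ) (c : List Unit) → Circuit n c →
    Σ Tri (λ T → IsHull n c T × ValidTri n T × StrictlyOverSaturated T c
      × (∀ T' → ValidTri n T' → StrictlyOverSaturated T' c → T' ≡ T))
proposition5p5 n [] (_ , dependent , _) = ⊥-elim (dependent λ _ _ → z≤n)
proposition5p5 n (x ∷ r) circuit@((_ , inGround) , dependent , _) =
  hull x r , isHull , proj₁ isHull ,
  hull-oversaturated isHull contains dependent ,
  oversaturated-unique isHull contains (circuit-count≤1+size circuit)
  where
  isHull : IsHull n (x ∷ r) (hull x r)
  isHull = hull-isHull x r inGround

  contains : ∀ T → ValidTri n T → StrictlyOverSaturated T (x ∷ r) → All (InTri T) (x ∷ r)
  contains T = oversaturated⇒contains circuit
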